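{- Let $k\ge 2$. If a graph $G=(V,E)$ without isolated vertices admits a $k$-community structure, then $G$ has a matching of size $k$.
   Context: $N_C(v)$ is the set of neighbours of $v$ in $C$. A $k$-community structure of $G=(V,E)$ is a partition $\{C_1,\dots,C_k\}$ of $V$ with $k\ge 2$ such that $|C_i|\ge 2$ for all $i$, and for all $i$, every $v\in C_i$ and every $j\ne i$: $\frac{|N_{C_i}(v)|}{|C_i|-1}\ge\frac{|N_{C_j}(v)|}{|C_j|}$. -}

module Defs where

open import Data.Nat using (ℕ; _*_; _≤_; _∸_)
open import Data.Fin using (Fin; _≟_)
open import Data.Bool using (Bool; true; false; _∧_; T)
open import Data.List using (length; filterᵇ; allFin)
open import Data.Product using (Σ; ∃; _×_)
open import Relation.Nullary using (¬_)
open import Relation.Nullary.Decidable using (⌊_⌋)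
open import Relation.Binary.PropositionalEquality using (_≡_; _≢_)

record Graph (n : ℕ) : Set where
  field
    adj     : Fin n → Fin n → Bool
    adj-sym : ∀ u v → adj u v ≡ adj v u
    loopless : ∀ v → adj v v ≡ false
open Graph public

Adj : ∀ {n} → Graph n → Fin n → Fin n → Set
Adj G u v = T (adj G u v)

NoIsolatedVertices : ∀ {n} → Graph n → Set
NoIsolatedVertices {n} G = ∀ (v : Fin n) → ∃ λ u → Adj G v u

-- A partition of V = Fin n into k labelled classes C_0 … C_{k-1},
-- given by the class map c : V → Fin k  (v ∈ C_i  iff  c v ≡ i).
-- |C_i|
classSize : ∀ {n k} → (Fin n → Fin k) → Fin k → ℕ
classSize {n} c i = length (filterᵇ (λ u → ⌊ c u ≟ i ⌋) (allFin n))

nbrsIn : ∀ {n k} → Graph n → (Fin n → Fin k) → Fin n → Fin k → ℕ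
nbrsIn {n} G c v j = length (filterᵇ (λ u → adj G v u ∧ ⌊ c u ≟ j ⌋) (allFin n))

-- k-community structure (k ≥ 2 is a separate hypothesis of the theorem):
-- every class has at least 2 vertices, and for all i, v ∈ C_i, j ≠ i,
--   |N_{C_i}(v)| / (|C_i| - 1)  ≥  |N_{C_j}(v)| / |C_j| ,
-- written with denominators cleared (both are positive since |C_i| ≥ 2):
--   |N_{C_j}(v)| * (|C_i| - 1)  ≤  |N_{C_i}(v)| * |C_j| .
IsCommunityStructure : ∀ {n k} → Graph n → (Fin n → Fin k) → Set
IsCommunityStructure {n} {k} G c =
  (∀ (i : Fin k) → 2 ≤ classSize c i) ×
  (∀ (v : Fin n) (j : Fin k) → j ≢ c v →
     nbrsIn G c v j * (classSize c (c v) ∸ 1) ≤ nbrsIn G c v (c v) * classSize c j)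

HasMatchingOfSize : ∀ {n} → Graph n → ℕ → Set
HasMatchingOfSize {n} G k =
  Σ (Fin k → Fin n) λ a → Σ (Fin k → Fin n) λ b →
    (∀ i → Adj G (a i) (b i)) ×
    (∀ i j → a i ≡ a j → i ≡ j) ×
    (∀ i j → b i ≡ b j → i ≡ j) ×
    (∀ i j → a i ≢ b j)

-- Every community C_i contains an edge. Pick v ∈ C_i (|C_i| ≥ 2) and a neighbour u of v.
-- If u ∉ C_i, then |N_{C(u)}(v)| (|C_i| - 1) > 0, so the community inequality forces
-- |N_{C_i}(v)| > 0. Edges inside distinct (disjoint) communities form a matching of size k.
module Submission where

open import Defs
open import Data.Nat using (ℕ; suc; _≤_; _<_; _*_; z<s)
open import Data.Nat.Properties using (*-mono-≤; ≤-trans; m<n⇒0<n; m<n⇒0<n∸m)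
open import Data.Fin using (Fin; _≟_)
open import Data.Bool using (Bool; T)
open import Data.Bool.Properties using (T-∧; T?)
open import Data.List using (List; _∷_; length; filterᵇ; allFin)
open import Data.List.Membership.Propositional using (_∈_)
open import Data.List.Membership.Propositional.Properties using (∈-filter⁺; ∈-filter⁻; ∈-allFin)
open import Data.List.Relation.Unary.Any using (here)
open import Data.Product using (∃; _×_; _,_; proj₁)
open import Function using (_∘_; Equivalence)
open import Relation.Nullary using (yes; no)
open import Relation.Nullary.Decidable using (toWitness; fromWitness)
open import Relation.Binary.PropositionalEquality using (_≡_; _≢_; refl; subst)
open Equivalence using (to; from)

∈⇒length>0 : ∀ {a} {A : Set a} {x : A} {xs : List A} → x ∈ xs → 0 < length xs
∈⇒length>0 {xs = _ ∷ _} _ = z<s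

length>0⇒∃-∈ : ∀ {a} {A : Set a} {xs : List A} → 0 < length xs → ∃ λ x → x ∈ xs
length>0⇒∃-∈ {xs = x ∷ _} _ = x , here refl

module _ {a} {A : Set a} (p : A → Bool) where

  length-filterᵇ>0⇒∃ : ∀ xs → 0 < length (filterᵇ p xs) → ∃ λ x → x ∈ xs × T (p x)
  length-filterᵇ>0⇒∃ _ pos with length>0⇒∃-∈ pos
  ... | x , x∈ = x , ∈-filter⁻ (T? ∘ p) x∈

  ∈∧T⇒length-filterᵇ>0 : ∀ {x xs} → x ∈ xs → T (p x) → 0 < length (filterᵇ p xs)
  ∈∧T⇒length-filterᵇ>0 x∈ px = ∈⇒length>0 (∈-filter⁺ (T? ∘ p) x∈ px)

*-positiveˡ : ∀ m n → 0 < m * n → 0 < m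
*-positiveˡ (suc _) _ _ = z<s

module _ {n k : ℕ} (G : Graph n) (c : Fin n → Fin k) where

  classSize>0⇒member : ∀ {i} → 0 < classSize c i → ∃ λ v → c v ≡ i
  classSize>0⇒member pos with length-filterᵇ>0⇒∃ _ (allFin n) pos
  ... | v , _ , v∈Cᵢ = v , toWitness v∈Cᵢ

  nbrsIn>0⇒neighbour : ∀ {v j} → 0 < nbrsIn G c v j → ∃ λ w → Adj G v w × c w ≡ j
  nbrsIn>0⇒neighbour {v} pos with length-filterᵇ>0⇒∃ _ (allFin n) pos
  ... | w , _ , t with to (T-∧ {adj G v w}) t
  ...   | vw , w∈Cⱼ = w , vw , toWitness w∈Cⱼ

  neighbour⇒nbrsIn>0 : ∀ {v w} → Adj G v w → 0 < nbrsIn G c v (c w)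
  neighbour⇒nbrsIn>0 {v} {w} vw =
    ∈∧T⇒length-filterᵇ>0 _ (∈-allFin w) (from (T-∧ {adj G v w}) (vw , fromWitness refl))

  neighbourInOwnClass : IsCommunityStructure G c →
    ∀ {v u} → Adj G v u → ∃ λ w → Adj G v w × c w ≡ c v
  neighbourInOwnClass (large , balanced) {v} {u} vu with c u ≟ c v
  ... | yes same = u , vu , same
  ... | no differ = nbrsIn>0⇒neighbour (*-positiveˡ _ (classSize c (c u)) ownNbrs×size>0)
    where
    ownNbrs×size>0 : 0 < nbrsIn G c v (c v) * classSize c (c u)
    ownNbrs×size>0 =
      ≤-trans (*-mono-≤ (neighbour⇒nbrsIn>0 vu) (m<n⇒0<n∸m (large (c v)))) (balanced v (c u) differ)

record EdgeInClass {n k : ℕ} (G : Graph n) (c : Fin n → Fin k) (i : Fin k) : Set where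
  field
    tail tip : Fin n
    tail∈ : c tail ≡ i
    tip∈  : c tip ≡ i
    edge  : Adj G tail tip

communityContainsEdge : ∀ {n k} (G : Graph n) (c : Fin n → Fin k) →
  NoIsolatedVertices G → IsCommunityStructure G c → ∀ i → EdgeInClass G c i
communityContainsEdge G c noIsolated community i
  with classSize>0⇒member G c (m<n⇒0<n (proj₁ community i))
... | v , refl with noIsolated v
...   | _ , vu with neighbourInOwnClass G c community vu
...     | w , vw , w∈ = record { tail = v ; tip = w ; tail∈ = refl ; tip∈ = w∈ ; edge = vw }

Adj⇒≢ : ∀ {n} (G : Graph n) {x y} → Adj G x y → x ≢ y
Adj⇒≢ G {x} xy refl = subst T (loopless G x) xy

classEdges⇒matching : ∀ {n k} (G : Graph n) (c : Fin n → Fin k) →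
  (∀ i → EdgeInClass G c i) → HasMatchingOfSize G k
classEdges⇒matching G c e =
  tail ∘ e , tip ∘ e , edge ∘ e ,
  (λ i j eq → sameClass (tail∈ (e i)) (tail∈ (e j)) eq) ,
  (λ i j eq → sameClass (tip∈ (e i)) (tip∈ (e j)) eq) ,
  tail≢tip
  where
  open EdgeInClass
  sameClass : ∀ {x y i j} → c x ≡ i → c y ≡ j → x ≡ y → i ≡ j
  sameClass refl refl refl = refl
  tail≢tip : ∀ i j → tail (e i) ≢ tip (e j)
  tail≢tip i j eq with sameClass (tail∈ (e i)) (tip∈ (e j)) eq
  ... | refl = Adj⇒≢ G (edge (e i)) eq

mainTheorem12 : (k : ℕ) → 2 ≤ k → (n : ℕ) → (G : Graph n) → NoIsolatedVertices G →
    ∃ (λ (c : Fin n → Fin k) → IsCommunityStructure G c) → HasMatchingOfSize G k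
mainTheorem12 k _ n G noIsolated (c , community) =
  classEdges⇒matching G c (communityContainsEdge G c noIsolated community)
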